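{- For every trigraph \(G\) and every vertex \(v\in V(G)\), \(\operatorname{tww}_{V(G)\setminus\{v\}}(G)\leq \operatorname{tww}(G)+1\).
   Context: A trigraph is a graph whose edges are partitioned into black and red edges. For distinct vertices \(x,y\), the contraction \(G/xy\) replaces \(x,y\) by a new vertex \(z\), keeps edges not incident to \(x,y\), joins \(z\) by a black edge to every common black neighbour of \(x,y\), and by a red edge to every other vertex adjacent to \(x\) or \(y\). A partial contraction sequence is a sequence of trigraphs each obtained from the previous by one contraction; its width is the maximum red degree occurring in it. \(\operatorname{tww}(G)\) is the minimum width of a partial contraction sequence ending in a single vertex. For \(U\subseteq V(G)\), a \(U\)-contraction sequence is a partial contraction sequence in which only (vertices arising from) vertices of \(U\) are contracted and after which \(U\) has been merged into a single vertex while all other vertices remain uncontracted; \(\operatorname{tww}_U(G)\) is the minimum width of a \(U\)-contraction sequence of \(G\). -}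

module Defs where

open import Data.Nat using (ℕ; _≤_)
open import Data.Fin using (Fin; _≟_)
open import Data.Fin.Base using ()
open import Data.Bool using (Bool; true; false; _∧_; not)
open import Data.List using (List; length; filterᵇ; allFin)
open import Data.Product using (Σ; ∃; _×_)
open import Relation.Binary.PropositionalEquality using (_≡_; _≢_)
open import Relation.Nullary.Decidable using (⌊_⌋)

data Adj : Set where
  none black red : Adj

record Trigraph (n : ℕ) : Set where
  field
    adj   : Fin n → Fin n → Adj
    sym   : ∀ u w → adj u w ≡ adj w u
    irrefl : ∀ u → adj u u ≡ none
open Trigraph public

-- A trigraph occurring during a contraction sequence of a trigraph on Fin n.
-- Vertex labels are taken from Fin n: 'alive' marks the current vertices; when
-- x and y are contracted, the new vertex z receives the label x and the label
-- y dies.  Adjacency involving dead labels is irrelevant.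
record State (n : ℕ) : Set where
  constructor ⟨_,_⟩
  field
    alive : Fin n → Bool
    sadj  : Fin n → Fin n → Adj
open State public

initial : ∀ {n} → Trigraph n → State n
initial G = ⟨ (λ _ → true) , adj G ⟩

merge : Adj → Adj → Adj
merge none  none  = none
merge black black = black
merge _     _     = red

_==_ : ∀ {n} → Fin n → Fin n → Bool
u == w = ⌊ u ≟ w ⌋

contract : ∀ {n} → State n → Fin n → Fin n → State n
contract {n} S x y = ⟨ alive′ , adj′ ⟩
  where
  alive′ : Fin n → Bool
  alive′ w = alive S w ∧ not (w == y)
  adj′ : Fin n → Fin n → Adj
  adj′ u w with u == x | w == x
  ... | true  | true  = none
  ... | true  | false = merge (sadj S x w) (sadj S y w)
  ... | false | true  = merge (sadj S u x) (sadj S u y)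
  ... | false | false = sadj S u w

isRed : Adj → Bool
isRed red = true
isRed _   = false

redDeg : ∀ {n} → State n → Fin n → ℕ
redDeg {n} S v = length (filterᵇ (λ w → alive S w ∧ isRed (sadj S v w)) (allFin n))

RedDeg≤ : ∀ {n} → ℕ → State n → Set
RedDeg≤ d S = ∀ v → alive S v ≡ true → redDeg S v ≤ d

-- Since a contracted
-- vertex keeps the label of one of the two contracted vertices, a current
-- vertex arises from U iff its label is in U.
data CSeq {n : ℕ} (U : Fin n → Bool) (d : ℕ) : State n → State n → Set where
  done : ∀ {S} → RedDeg≤ d S → CSeq U d S S
  step : ∀ {S T} (x y : Fin n) → RedDeg≤ d S →
         alive S x ≡ true → alive S y ≡ true → x ≢ y →
         U x ≡ true → U y ≡ true →
         CSeq U d (contract S x y) T → CSeq U d S T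

everything : ∀ {n} → Fin n → Bool
everything _ = true

SingleVertex : ∀ {n} → State n → Set
SingleVertex {n} S = Σ (Fin n) λ u → alive S u ≡ true × (∀ w → alive S w ≡ true → w ≡ u)

HasSeq : ∀ {n} → Trigraph n → ℕ → Set
HasSeq G d = ∃ λ T → CSeq everything d (initial G) T × SingleVertex T

UMerged : ∀ {n} → (Fin n → Bool) → State n → Set
UMerged {n} U S =
  (Σ (Fin n) λ u → U u ≡ true × alive S u ≡ true ×
      (∀ w → U w ≡ true → alive S w ≡ true → w ≡ u))
  × (∀ w → U w ≡ false → alive S w ≡ true)

HasUSeq : ∀ {n} → Trigraph n → (Fin n → Bool) → ℕ → Set
HasUSeq G U d = ∃ λ T → CSeq U d (initial G) T × UMerged U T

IsTww : ∀ {n} → Trigraph n → ℕ → Set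
IsTww G t = HasSeq G t × (∀ d → HasSeq G d → t ≤ d)

IsTwwU : ∀ {n} → Trigraph n → (Fin n → Bool) → ℕ → Set
IsTwwU G U t = HasUSeq G U t × (∀ d → HasUSeq G U d → t ≤ d)

allBut : ∀ {n} → Fin n → Fin n → Bool
allBut v w = not (w == v)

{-# OPTIONS --safe #-}
-- Simulate a contraction sequence of G of width t while keeping v apart:
-- whenever the old sequence merges two parts, merge the same two parts with v
-- removed, and do nothing when one of them is {v}.  Every trigraph in either
-- sequence is the quotient of G by its current partition: two parts are joined
-- by a black edge or by no edge exactly when all pairs between them are, and by
-- a red edge otherwise.  Hence a red edge between new parts lies inside a red
-- edge between the corresponding old parts, and sending a new part to its old
-- part is injective except that {v} and the rest of v's old part collide.  So
-- red degrees grow by at most one, and when the old sequence has reached a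
-- single vertex, V(G) ∖ {v} has been merged.
module Submission where

open import Defs hiding (sym)
open import Data.Nat using (ℕ; _≤_; _+_; suc; z≤n; s≤s)
open import Data.Nat.Properties using (≤-trans; +-mono-≤; +-monoˡ-≤; +-suc)
open import Data.Fin using (Fin; _≟_)
open import Data.Fin.Properties using (injective⇒≤; any?)
open import Data.Bool using (Bool; true; false; _∧_; not)
open import Data.Bool.Properties using (∧-conicalˡ; ∧-conicalʳ; not-injective; T-≡)
open import Data.List using (List; []; _∷_; length; filterᵇ; allFin; lookup)
open import Data.List.Membership.Propositional using (_∈_)
open import Data.List.Membership.Propositional.Properties using (∈-filter⁺; ∈-filter⁻; ∈-allFin; ∈-lookup)
open import Data.List.Relation.Unary.Any using (here; there; index)
open import Data.List.Relation.Unary.Any.Properties using (lookup-index)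
open import Data.List.Relation.Unary.All as All using ()
open import Data.List.Relation.Unary.AllPairs using (_∷_)
open import Data.List.Relation.Unary.Unique.Propositional using (Unique)
open import Data.List.Relation.Unary.Unique.Propositional.Properties using (allFin⁺; filter⁺)
open import Data.Product using (∃; _×_; _,_; proj₁; proj₂)
open import Data.Product.Function.NonDependent.Propositional using (_×-⇔_)
open import Data.Sum as Sum using (_⊎_; inj₁; inj₂)
open import Data.Empty using (⊥; ⊥-elim)
open import Function using (_∘_; id)
open import Function.Bundles using (_⇔_; mk⇔; Equivalence)
open import Function.Definitions using (Injective)
open import Function.Related.Propositional using (module EquationalReasoning; equivalence)
import Function.Properties.Equivalence as ⇔
open import Level using (0ℓ)
open import Relation.Nullary using (¬_; Dec; yes; no; contradiction)
open import Relation.Nullary.Decidable using (T?; does; _⊎-dec_; _×-dec_; ¬?)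
open import Relation.Unary using (Pred; Decidable; _∪_; _≐_)
open import Relation.Binary.PropositionalEquality
  using (_≡_; _≢_; refl; sym; trans; cong; cong₂; subst; ≢-sym; module ≡-Reasoning)

private
  variable
    n : ℕ

-- Counting

module _ {a} {A : Set a} where

  lookup-injective : {xs : List A} → Unique xs → Injective _≡_ _≡_ (lookup xs)
  lookup-injective {_ ∷ _} _        {Fin.zero}  {Fin.zero}  _  = refl
  lookup-injective {_ ∷ _} (x≢ ∷ _) {Fin.zero}  {Fin.suc j} eq = contradiction eq (All.lookup x≢ (∈-lookup j))
  lookup-injective {_ ∷ _} (x≢ ∷ _) {Fin.suc i} {Fin.zero}  eq = contradiction (sym eq) (All.lookup x≢ (∈-lookup i))
  lookup-injective {_ ∷ _} (_ ∷ u)  {Fin.suc i} {Fin.suc j} eq = cong Fin.suc (lookup-injective u eq)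

  length-≤-injection : ∀ {b} {B : Set b} {xs : List A} {ys : List B} (f : A → B) → Unique xs →
    (∀ {x} → x ∈ xs → f x ∈ ys) → (∀ {x y} → x ∈ xs → y ∈ xs → f x ≡ f y → x ≡ y) →
    length xs ≤ length ys
  length-≤-injection {xs = xs} {ys} f u into inj = injective⇒≤ position-injective
    where
    position : Fin (length xs) → Fin (length ys)
    position i = index (into (∈-lookup i))

    position-injective : Injective _≡_ _≡_ position
    position-injective {i} {j} eq = lookup-injective u (inj (∈-lookup i) (∈-lookup j) (begin
      f (lookup xs i)        ≡⟨ lookup-index (into (∈-lookup i)) ⟩
      lookup ys (position i) ≡⟨ cong (lookup ys) eq ⟩
      lookup ys (position j) ≡⟨ lookup-index (into (∈-lookup j)) ⟨
      f (lookup xs j)        ∎))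
      where open ≡-Reasoning

  length-≤-1 : {xs : List A} → Unique xs → (∀ {x y} → x ∈ xs → y ∈ xs → x ≡ y) → length xs ≤ 1
  length-≤-1 {[]}            _                  _         = z≤n
  length-≤-1 {_ ∷ []}        _                  _         = s≤s z≤n
  length-≤-1 {_ ∷ _ ∷ _} ((x≢y All.∷ _) ∷ _) all-equal =
    contradiction (all-equal (here refl) (there (here refl))) x≢y

  length-filterᵇ-split : (P E : A → Bool) (xs : List A) →
    length (filterᵇ P xs) ≡
    length (filterᵇ (λ x → P x ∧ not (E x)) xs) + length (filterᵇ (λ x → P x ∧ E x) xs)
  length-filterᵇ-split P E [] = refl
  length-filterᵇ-split P E (x ∷ xs) with P x | E x
  ... | false | _     = length-filterᵇ-split P E xs
  ... | true  | false = cong suc (length-filterᵇ-split P E xs)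
  ... | true  | true  = trans (cong suc (length-filterᵇ-split P E xs)) (sym (+-suc _ _))

count : (Fin n → Bool) → ℕ
count {n} P = length (filterᵇ P (allFin n))

∈-filterᵇ⁻ : {P : Fin n → Bool} {w : Fin n} → w ∈ filterᵇ P (allFin n) → P w ≡ true
∈-filterᵇ⁻ {P = P} w∈ = Equivalence.to T-≡ (proj₂ (∈-filter⁻ (T? ∘ P) {xs = allFin _} w∈))

∈-filterᵇ⁺ : {P : Fin n → Bool} {w : Fin n} → P w ≡ true → w ∈ filterᵇ P (allFin n)
∈-filterᵇ⁺ {P = P} {w} Pw = ∈-filter⁺ (T? ∘ P) (∈-allFin w) (Equivalence.from T-≡ Pw)

module _ {P : Fin n → Bool} where

  unique-filterᵇ : Unique (filterᵇ P (allFin n))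
  unique-filterᵇ = filter⁺ (T? ∘ P) (allFin⁺ n)

  count-≤-injection : {Q : Fin n → Bool} (f : Fin n → Fin n) →
    (∀ {w} → P w ≡ true → Q (f w) ≡ true) →
    (∀ {u w} → P u ≡ true → P w ≡ true → f u ≡ f w → u ≡ w) →
    count P ≤ count Q
  count-≤-injection {Q} f into inj = length-≤-injection {ys = filterᵇ Q (allFin n)} f unique-filterᵇ
    (∈-filterᵇ⁺ ∘ into ∘ ∈-filterᵇ⁻) (λ u∈ w∈ → inj (∈-filterᵇ⁻ u∈) (∈-filterᵇ⁻ w∈))

  count-≤-1 : (∀ {u w} → P u ≡ true → P w ≡ true → u ≡ w) → count P ≤ 1
  count-≤-1 all-equal =
    length-≤-1 unique-filterᵇ (λ u∈ w∈ → all-equal (∈-filterᵇ⁻ u∈) (∈-filterᵇ⁻ w∈))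

∧-does : ∀ {a} {A : Set a} {b} (A? : Dec A) → (b ∧ does A?) ≡ true → b ≡ true × A
∧-does {b = true} (yes a) _ = refl , a

∧-not-does : ∀ {a} {A : Set a} {b} (A? : Dec A) → (b ∧ not (does A?)) ≡ true → b ≡ true × ¬ A
∧-not-does {b = true} (no ¬a) _ = refl , ¬a

count-≤-injection-but-one : {P Q : Fin n → Bool} {E : Pred (Fin n) 0ℓ} (E? : Decidable E) (f : Fin n → Fin n) →
  (∀ {u w} → P u ≡ true → P w ≡ true → E u → E w → u ≡ w) →
  (∀ {w} → P w ≡ true → ¬ E w → Q (f w) ≡ true) →
  (∀ {u w} → P u ≡ true → P w ≡ true → ¬ E u → ¬ E w → f u ≡ f w → u ≡ w) →
  count P ≤ count Q + 1
count-≤-injection-but-one {n} {P} {Q} {E} E? f exceptional-unique into inj =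
  subst (_≤ count Q + 1) (sym (length-filterᵇ-split P (does ∘ E?) (allFin n)))
    (+-mono-≤ (count-≤-injection f (λ Pw → let Pw , ¬Ew = regular Pw in into Pw ¬Ew)
                 (λ Pu Pw → let Pu , ¬Eu = regular Pu ; Pw , ¬Ew = regular Pw in inj Pu Pw ¬Eu ¬Ew))
              (count-≤-1 (λ Pu Pw → let Pu , Eu = exceptional Pu ; Pw , Ew = exceptional Pw in
                 exceptional-unique Pu Pw Eu Ew)))
  where
  regular : ∀ {w} → (P w ∧ not (does (E? w))) ≡ true → P w ≡ true × ¬ E w
  regular {w} = ∧-not-does (E? w)
  exceptional : ∀ {w} → (P w ∧ does (E? w)) ≡ true → P w ≡ true × E w
  exceptional {w} = ∧-does (E? w)

-- Contractions and partitions

==-≢ : {a b : Fin n} → a ≢ b → (a == b) ≡ false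
==-≢ {a = a} {b} a≢b with a ≟ b
... | yes a≡b = contradiction a≡b a≢b
... | no _    = refl

==-true⇒≡ : {a b : Fin n} → (a == b) ≡ true → a ≡ b
==-true⇒≡ {a = a} {b} e with a ≟ b | e
... | yes a≡b | _ = a≡b
... | no _    | ()

==-false⇒≢ : {a b : Fin n} → (a == b) ≡ false → a ≢ b
==-false⇒≢ {a = a} {b} e with a ≟ b | e
... | yes _   | ()
... | no a≢b  | _ = a≢b

allBut-true : {v w : Fin n} → w ≢ v → allBut v w ≡ true
allBut-true w≢v = cong not (==-≢ w≢v)

allBut-true⇒≢ : {v w : Fin n} → allBut v w ≡ true → w ≢ v
allBut-true⇒≢ = ==-false⇒≢ ∘ not-injective

allBut-false⇒≡ : {v w : Fin n} → allBut v w ≡ false → w ≡ v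
allBut-false⇒≡ = ==-true⇒≡ ∘ not-injective

module _ (S : State n) (x y : Fin n) where

  alive-contract⁺ : ∀ {w} → alive S w ≡ true → w ≢ y → alive (contract S x y) w ≡ true
  alive-contract⁺ {w} aw w≢y rewrite aw | ==-≢ w≢y = refl

  alive-contract⁻ : ∀ {w} → alive (contract S x y) w ≡ true → alive S w ≡ true × w ≢ y
  alive-contract⁻ {w} aw = ∧-conicalˡ _ _ aw , ==-false⇒≢ (not-injective (∧-conicalʳ (alive S w) _ aw))

merge-≡ : ∀ {s t c} → c ≢ red → merge s t ≡ c ⇔ (s ≡ c × t ≡ c)
merge-≡ {c = c} c≢red = mk⇔ to (λ { (refl , refl) → merge-idem c≢red })
  where
  merge-idem : ∀ {c} → c ≢ red → merge c c ≡ c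
  merge-idem {none}  _     = refl
  merge-idem {black} _     = refl
  merge-idem {red}   c≢red = contradiction refl c≢red
  to : ∀ {s t} → merge s t ≡ c → s ≡ c × t ≡ c
  to {none}  {none}  refl = refl , refl
  to {black} {black} refl = refl , refl
  to {none}  {black} refl = contradiction refl c≢red
  to {none}  {red}   refl = contradiction refl c≢red
  to {black} {none}  refl = contradiction refl c≢red
  to {black} {red}   refl = contradiction refl c≢red
  to {red}           refl = contradiction refl c≢red

red-unless-nonred : (s : Adj) → (∀ {c} → c ≢ red → s ≡ c → ⊥) → s ≡ red
red-unless-nonred none  nonred = ⊥-elim (nonred (λ ()) refl)
red-unless-nonred black nonred = ⊥-elim (nonred (λ ()) refl)
red-unless-nonred red   _      = refl

_∈[_,_] : Fin n → Fin n → Fin n → Set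
c ∈[ x , y ] = c ≡ x ⊎ c ≡ y

_∈[_,_]? : (c x y : Fin n) → Dec (c ∈[ x , y ])
c ∈[ x , y ]? = (c ≟ x) ⊎-dec (c ≟ y)

∈[,]-besides : {x y z c d : Fin n} → z ∈[ x , y ] → c ∈[ x , y ] → d ∈[ x , y ] → c ≢ z → d ≢ z → c ≡ d
∈[,]-besides (inj₁ refl) (inj₁ refl) _           c≢z _   = contradiction refl c≢z
∈[,]-besides (inj₁ refl) _           (inj₁ refl) _   d≢z = contradiction refl d≢z
∈[,]-besides (inj₂ refl) (inj₂ refl) _           c≢z _   = contradiction refl c≢z
∈[,]-besides (inj₂ refl) _           (inj₂ refl) _   d≢z = contradiction refl d≢z
∈[,]-besides _           (inj₁ refl) (inj₁ refl) _   _   = refl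
∈[,]-besides _           (inj₂ refl) (inj₂ refl) _   _   = refl

-- How contract S x y changes the label of a part.
relabel : Fin n → Fin n → Fin n → Fin n
relabel x y c with c ≟ y
... | yes _ = x
... | no  _ = c

module _ {x y : Fin n} where

  relabel-fixes : ∀ {c} → c ≢ y → relabel x y c ≡ c
  relabel-fixes {c} c≢y with c ≟ y
  ... | yes c≡y = contradiction c≡y c≢y
  ... | no  _   = refl

  relabel-≡-x : ∀ {c} → relabel x y c ≡ x ⇔ c ∈[ x , y ]
  relabel-≡-x {c} = mk⇔ to from
    where
    to : relabel x y c ≡ x → c ∈[ x , y ]
    to e with c ≟ y
    ... | yes c≡y = inj₂ c≡y
    ... | no  _   = inj₁ e
    from : c ∈[ x , y ] → relabel x y c ≡ x
    from c∈ with c ≟ y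
    ... | yes _   = refl
    ... | no  c≢y = Sum.[ id , (λ c≡y → contradiction c≡y c≢y) ] c∈

  relabel-≡-other : ∀ {a c} → a ≢ x → a ≢ y → relabel x y c ≡ a ⇔ c ≡ a
  relabel-≡-other {a} {c} a≢x a≢y = mk⇔ to (λ { refl → relabel-fixes a≢y })
    where
    to : relabel x y c ≡ a → c ≡ a
    to e with c ≟ y
    ... | yes _ = contradiction (sym e) a≢x
    ... | no  _ = e

  relabel-≡-relabel : ∀ {c d} → relabel x y c ≡ relabel x y d ⇔ (c ≡ d ⊎ (c ∈[ x , y ] × d ∈[ x , y ]))
  relabel-≡-relabel {c} {d} = mk⇔ to from
    where
    to : relabel x y c ≡ relabel x y d → c ≡ d ⊎ (c ∈[ x , y ] × d ∈[ x , y ])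
    to e with c ∈[ x , y ]?
    ... | yes c∈ = inj₂ (c∈ , Equivalence.to relabel-≡-x (trans (sym e) (Equivalence.from relabel-≡-x c∈)))
    ... | no  c∉ = inj₁ (sym (Equivalence.to (relabel-≡-other (c∉ ∘ inj₁) (c∉ ∘ inj₂))
                                (trans (sym e) (relabel-fixes (c∉ ∘ inj₂)))))
    from : c ≡ d ⊎ (c ∈[ x , y ] × d ∈[ x , y ]) → relabel x y c ≡ relabel x y d
    from (inj₁ refl)         = refl
    from (inj₂ (c∈ , d∈)) = trans (Equivalence.from relabel-≡-x c∈) (sym (Equivalence.from relabel-≡-x d∈))

relabel-≡-transfer : {x y a b c d c′ d′ : Fin n} →
  (c ≡ d → c′ ≡ d′) → (c ∈[ a , b ] → c′ ∈[ x , y ]) → (d ∈[ a , b ] → d′ ∈[ x , y ]) →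
  relabel a b c ≡ relabel a b d → relabel x y c′ ≡ relabel x y d′
relabel-≡-transfer same c∈ d∈ e with Equivalence.to relabel-≡-relabel e
... | inj₁ c≡d          = cong (relabel _ _) (same c≡d)
... | inj₂ (c∈′ , d∈′) = Equivalence.from relabel-≡-relabel (inj₂ (c∈ c∈′ , d∈ d∈′))

Part : (Fin n → Fin n) → Fin n → Pred (Fin n) 0ℓ
Part p a u = p u ≡ a

part-relabel-x : {p : Fin n → Fin n} {x y : Fin n} → (Part p x ∪ Part p y) ≐ Part (relabel x y ∘ p) x
part-relabel-x = Equivalence.from relabel-≡-x , Equivalence.to relabel-≡-x

part-relabel-other : {p : Fin n → Fin n} {x y a : Fin n} → a ≢ x → a ≢ y → Part p a ≐ Part (relabel x y ∘ p) a
part-relabel-other a≢x a≢y =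
  Equivalence.from (relabel-≡-other a≢x a≢y) , Equivalence.to (relabel-≡-other a≢x a≢y)

-- Quotient trigraphs

Homogeneous : Trigraph n → Adj → Pred (Fin n) 0ℓ → Pred (Fin n) 0ℓ → Set
Homogeneous G c A B = ∀ {u w} → A u → B w → adj G u w ≡ c

module Homogeneity (G : Trigraph n) (c : Adj) where

  homogeneous-cong : {A A′ B B′ : Pred (Fin n) 0ℓ} → A ≐ A′ → B ≐ B′ →
    Homogeneous G c A B ⇔ Homogeneous G c A′ B′
  homogeneous-cong {A} {A′} {B} {B′} (A⊆A′ , A′⊆A) (B⊆B′ , B′⊆B) = mk⇔ to from
    where
    to : Homogeneous G c A B → Homogeneous G c A′ B′
    to h u∈ w∈ = h (A′⊆A u∈) (B′⊆B w∈)
    from : Homogeneous G c A′ B′ → Homogeneous G c A B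
    from h u∈ w∈ = h (A⊆A′ u∈) (B⊆B′ w∈)

  homogeneous-∪ˡ : {A A′ B : Pred (Fin n) 0ℓ} →
    Homogeneous G c (A ∪ A′) B ⇔ (Homogeneous G c A B × Homogeneous G c A′ B)
  homogeneous-∪ˡ {A} {A′} {B} = mk⇔ to from
    where
    to : Homogeneous G c (A ∪ A′) B → Homogeneous G c A B × Homogeneous G c A′ B
    to h = (λ u∈ → h (inj₁ u∈)) , (λ u∈ → h (inj₂ u∈))
    from : Homogeneous G c A B × Homogeneous G c A′ B → Homogeneous G c (A ∪ A′) B
    from (h , _) (inj₁ u∈) = h u∈
    from (_ , h) (inj₂ u∈) = h u∈

  homogeneous-∪ʳ : {A B B′ : Pred (Fin n) 0ℓ} →
    Homogeneous G c A (B ∪ B′) ⇔ (Homogeneous G c A B × Homogeneous G c A B′)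
  homogeneous-∪ʳ {A} {B} {B′} = mk⇔ to from
    where
    to : Homogeneous G c A (B ∪ B′) → Homogeneous G c A B × Homogeneous G c A B′
    to h = (λ u∈ w∈ → h u∈ (inj₁ w∈)) , (λ u∈ w∈ → h u∈ (inj₂ w∈))
    from : Homogeneous G c A B × Homogeneous G c A B′ → Homogeneous G c A (B ∪ B′)
    from (h , _) u∈ (inj₁ w∈) = h u∈ w∈
    from (_ , h) u∈ (inj₂ w∈) = h u∈ w∈

-- p u is the label of the part containing u; the labels are exactly the
-- alive vertices of S.
record IsQuotient (G : Trigraph n) (S : State n) (p : Fin n → Fin n) : Set where
  field
    rep-alive   : ∀ u → alive S (p u) ≡ true
    rep-fixed   : ∀ {a} → alive S a ≡ true → p a ≡ a
    loopless    : ∀ a → sadj S a a ≡ none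
    homogeneous : ∀ {a b c} → alive S a ≡ true → alive S b ≡ true → a ≢ b → c ≢ red →
                  sadj S a b ≡ c ⇔ Homogeneous G c (Part p a) (Part p b)

isQuotient-initial : (G : Trigraph n) → IsQuotient G (initial G) id
isQuotient-initial G = record
  { rep-alive   = λ _ → refl
  ; rep-fixed   = λ _ → refl
  ; loopless    = irrefl G
  ; homogeneous = λ _ _ _ _ → mk⇔ (λ { e refl refl → e }) (λ h → h refl refl)
  }

isQuotient-contract : {G : Trigraph n} {S : State n} {p : Fin n → Fin n} {x y : Fin n} →
  IsQuotient G S p → alive S x ≡ true → alive S y ≡ true → x ≢ y →
  IsQuotient G (contract S x y) (relabel x y ∘ p)
isQuotient-contract {G = G} {S} {p} {x} {y} Q ax ay x≢y = record
  { rep-alive   = rep-alive′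
  ; rep-fixed   = rep-fixed′
  ; loopless    = loopless′
  ; homogeneous = homogeneous′
  }
  where
  open IsQuotient Q
  open EquationalReasoning {k = equivalence}
  S′ = contract S x y
  p′ = relabel x y ∘ p

  part-x : (Part p x ∪ Part p y) ≐ Part p′ x
  part-x = part-relabel-x

  part-other : ∀ {a} → a ≢ x → a ≢ y → Part p a ≐ Part p′ a
  part-other = part-relabel-other

  rep-alive′ : ∀ u → alive S′ (p′ u) ≡ true
  rep-alive′ u with p u ≟ y
  ... | yes _   = alive-contract⁺ S x y ax x≢y
  ... | no pu≢y = alive-contract⁺ S x y (rep-alive u) pu≢y

  rep-fixed′ : ∀ {a} → alive S′ a ≡ true → p′ a ≡ a
  rep-fixed′ aa′ = let aa , a≢y = alive-contract⁻ S x y aa′ in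
    trans (cong (relabel x y) (rep-fixed aa)) (relabel-fixes a≢y)

  loopless′ : ∀ a → sadj S′ a a ≡ none
  loopless′ a with a ≟ x
  ... | yes refl = refl
  ... | no  _    = loopless a

  merged-left : ∀ {b c} → alive S b ≡ true → b ≢ x → b ≢ y → c ≢ red →
    merge (sadj S x b) (sadj S y b) ≡ c ⇔ Homogeneous G c (Part p′ x) (Part p′ b)
  merged-left {b} {c} ab b≢x b≢y c≢red = begin
    merge (sadj S x b) (sadj S y b) ≡ c          ∼⟨ merge-≡ c≢red ⟩
    (sadj S x b ≡ c × sadj S y b ≡ c)            ∼⟨ homogeneous ax ab (≢-sym b≢x) c≢red
                                                     ×-⇔ homogeneous ay ab (≢-sym b≢y) c≢red ⟩
    (Homogeneous G c (Part p x) (Part p b) × Homogeneous G c (Part p y) (Part p b))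
                                                 ∼⟨ ⇔.sym homogeneous-∪ˡ ⟩
    Homogeneous G c (Part p x ∪ Part p y) (Part p b)
                                                 ∼⟨ homogeneous-cong part-x (part-other b≢x b≢y) ⟩
    Homogeneous G c (Part p′ x) (Part p′ b)      ∎
    where open Homogeneity G c

  merged-right : ∀ {a c} → alive S a ≡ true → a ≢ x → a ≢ y → c ≢ red →
    merge (sadj S a x) (sadj S a y) ≡ c ⇔ Homogeneous G c (Part p′ a) (Part p′ x)
  merged-right {a} {c} aa a≢x a≢y c≢red = begin
    merge (sadj S a x) (sadj S a y) ≡ c          ∼⟨ merge-≡ c≢red ⟩
    (sadj S a x ≡ c × sadj S a y ≡ c)            ∼⟨ homogeneous aa ax a≢x c≢red
                                                     ×-⇔ homogeneous aa ay a≢y c≢red ⟩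
    (Homogeneous G c (Part p a) (Part p x) × Homogeneous G c (Part p a) (Part p y))
                                                 ∼⟨ ⇔.sym homogeneous-∪ʳ ⟩
    Homogeneous G c (Part p a) (Part p x ∪ Part p y)
                                                 ∼⟨ homogeneous-cong (part-other a≢x a≢y) part-x ⟩
    Homogeneous G c (Part p′ a) (Part p′ x)      ∎
    where open Homogeneity G c

  untouched : ∀ {a b c} → alive S a ≡ true → alive S b ≡ true → a ≢ b →
    a ≢ x → a ≢ y → b ≢ x → b ≢ y → c ≢ red →
    sadj S a b ≡ c ⇔ Homogeneous G c (Part p′ a) (Part p′ b)
  untouched {a} {b} {c} aa ab a≢b a≢x a≢y b≢x b≢y c≢red = begin
    sadj S a b ≡ c                               ∼⟨ homogeneous aa ab a≢b c≢red ⟩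
    Homogeneous G c (Part p a) (Part p b)        ∼⟨ homogeneous-cong (part-other a≢x a≢y) (part-other b≢x b≢y) ⟩
    Homogeneous G c (Part p′ a) (Part p′ b)      ∎
    where open Homogeneity G c

  homogeneous′ : ∀ {a b c} → alive S′ a ≡ true → alive S′ b ≡ true → a ≢ b → c ≢ red →
                 sadj S′ a b ≡ c ⇔ Homogeneous G c (Part p′ a) (Part p′ b)
  homogeneous′ {a} {b} aa′ ab′ a≢b c≢red
    with alive-contract⁻ S x y aa′ | alive-contract⁻ S x y ab′ | a ≟ x | b ≟ x
  ... | _         | _         | yes refl | yes refl = contradiction refl a≢b
  ... | _         | ab , b≢y  | yes refl | no b≢x  = merged-left ab b≢x b≢y c≢red
  ... | aa , a≢y  | _         | no a≢x   | yes refl = merged-right aa a≢x a≢y c≢red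
  ... | aa , a≢y  | ab , b≢y  | no a≢x   | no b≢x  = untouched aa ab a≢b a≢x a≢y b≢x b≢y c≢red

red-in-coarser : {G : Trigraph n} {S S′ : State n} {p q : Fin n → Fin n} →
  IsQuotient G S p → IsQuotient G S′ q → (∀ {u w} → q u ≡ q w → p u ≡ p w) →
  ∀ {a b} → alive S′ a ≡ true → alive S′ b ≡ true → p a ≢ p b → sadj S′ a b ≡ red →
  sadj S (p a) (p b) ≡ red
red-in-coarser {G = G} {S} {p = p} {q} Qp Qq refines {a} {b} aa ab pa≢pb red′ =
  red-unless-nonred (sadj S (p a) (p b)) nonred
  where
  open IsQuotient
  nonred : ∀ {c} → c ≢ red → sadj S (p a) (p b) ≡ c → ⊥
  nonred {c} c≢red ≡c =
    c≢red (trans (sym (Equivalence.from (homogeneous Qq aa ab (pa≢pb ∘ cong p) c≢red) fine)) red′)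
    where
    coarse : Homogeneous G c (Part p (p a)) (Part p (p b))
    coarse = Equivalence.to (homogeneous Qp (rep-alive Qp a) (rep-alive Qp b) pa≢pb c≢red) ≡c
    fine : Homogeneous G c (Part q a) (Part q b)
    fine qu≡a qw≡b = coarse (refines (trans qu≡a (sym (rep-fixed Qq aa)))) (refines (trans qw≡b (sym (rep-fixed Qq ab))))

-- Keeping v apart

-- q describes the partition obtained from that of p by splitting v off into
-- a part of its own.
record SplitOff (v : Fin n) (p q : Fin n → Fin n) : Set where
  field
    v-fixed : q v ≡ v
    v-alone : ∀ {u} → u ≢ v → q u ≢ v
    refines : ∀ {u w} → q u ≡ q w → p u ≡ p w
    agrees  : ∀ {u w} → u ≢ v → w ≢ v → p u ≡ p w → q u ≡ q w

splitOff-initial : (v : Fin n) → SplitOff v id id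
splitOff-initial v = record { v-fixed = refl ; v-alone = id ; refines = id ; agrees = λ _ _ → id }

splitOff-contract : {v x y a b : Fin n} {p q : Fin n → Fin n} → SplitOff v p q → a ≢ v → b ≢ v →
  (∀ {u} → q u ∈[ a , b ] → p u ∈[ x , y ]) → (∀ {u} → u ≢ v → p u ∈[ x , y ] → q u ∈[ a , b ]) →
  SplitOff v (relabel x y ∘ p) (relabel a b ∘ q)
splitOff-contract split a≢v b≢v old-pair new-pair = record
  { v-fixed = trans (cong (relabel _ _) v-fixed) (relabel-fixes (≢-sym b≢v))
  ; v-alone = λ u≢v → v-alone u≢v ∘ Equivalence.to (relabel-≡-other (≢-sym a≢v) (≢-sym b≢v))
  ; refines = relabel-≡-transfer refines old-pair old-pair
  ; agrees  = λ u≢v w≢v → relabel-≡-transfer (agrees u≢v w≢v) (new-pair u≢v) (new-pair w≢v)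
  }
  where open SplitOff split

splitOff-skip : {v x y z : Fin n} {p q : Fin n → Fin n} → SplitOff v p q → z ∈[ x , y ] →
  (∀ {u} → u ≢ v → p u ≢ z) → SplitOff v (relabel x y ∘ p) q
splitOff-skip {v = v} {x} {y} {p = p} {q} split z∈ outside-z = record
  { v-fixed = v-fixed
  ; v-alone = v-alone
  ; refines = cong (relabel x y) ∘ refines
  ; agrees  = agrees′
  }
  where
  open SplitOff split
  agrees′ : ∀ {u w} → u ≢ v → w ≢ v → relabel x y (p u) ≡ relabel x y (p w) → q u ≡ q w
  agrees′ u≢v w≢v e with Equivalence.to relabel-≡-relabel e
  ... | inj₁ pu≡pw        = agrees u≢v w≢v pu≡pw
  ... | inj₂ (pu∈ , pw∈) = agrees u≢v w≢v (∈[,]-besides z∈ pu∈ pw∈ (outside-z u≢v) (outside-z w≢v))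

isRed-true : ∀ {c} → isRed c ≡ true → c ≡ red
isRed-true {red} _ = refl

redDeg-splitOff : {G : Trigraph n} {S S′ : State n} {p q : Fin n → Fin n} {v : Fin n} {t : ℕ} →
  IsQuotient G S p → IsQuotient G S′ q → SplitOff v p q → RedDeg≤ t S → RedDeg≤ (t + 1) S′
redDeg-splitOff {n} {S = S} {S′} {p} {q} {v} Qp Qq split rd a aa =
  ≤-trans bound (+-monoˡ-≤ 1 (rd (p a) (rep-alive Qp a)))
  where
  open IsQuotient
  open SplitOff split

  RedNeighbour : Fin n → Set
  RedNeighbour w = (alive S′ w ∧ isRed (sadj S′ a w)) ≡ true

  Exceptional : Pred (Fin n) 0ℓ
  Exceptional w = w ≡ v ⊎ p w ≡ p a

  red-neighbour : ∀ {w} → RedNeighbour w → alive S′ w ≡ true × sadj S′ a w ≡ red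
  red-neighbour {w} e = ∧-conicalˡ _ _ e , isRed-true (∧-conicalʳ (alive S′ w) _ e)

  ≢a : ∀ {w} → RedNeighbour w → w ≢ a
  ≢a Rw refl with () ← trans (sym (proj₂ (red-neighbour Rw))) (loopless Qq a)

  injective-off-v : ∀ {u w} → alive S′ u ≡ true → alive S′ w ≡ true → u ≢ v → w ≢ v → p u ≡ p w → u ≡ w
  injective-off-v au aw u≢v w≢v pu≡pw =
    trans (sym (rep-fixed Qq au)) (trans (agrees u≢v w≢v pu≡pw) (rep-fixed Qq aw))

  -- If a = v, an exceptional red neighbour lies in the old part of v but is not
  -- v; otherwise it is v itself.
  exceptional-unique : ∀ {u w} → RedNeighbour u → RedNeighbour w → Exceptional u → Exceptional w → u ≡ w
  exceptional-unique Ru Rw Eu Ew with a ≟ v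
  ... | yes refl = injective-off-v (proj₁ (red-neighbour Ru)) (proj₁ (red-neighbour Rw)) (≢a Ru) (≢a Rw)
                     (trans (in-part Eu (≢a Ru)) (sym (in-part Ew (≢a Rw))))
    where
    in-part : ∀ {w} → Exceptional w → w ≢ a → p w ≡ p a
    in-part (inj₁ w≡a)   w≢a = contradiction w≡a w≢a
    in-part (inj₂ pw≡pa) _   = pw≡pa
  ... | no a≢v = trans (is-v Ru Eu) (sym (is-v Rw Ew))
    where
    is-v : ∀ {w} → RedNeighbour w → Exceptional w → w ≡ v
    is-v _ (inj₁ w≡v) = w≡v
    is-v {w} Rw (inj₂ pw≡pa) with w ≟ v
    ... | yes w≡v = w≡v
    ... | no  w≢v = contradiction (injective-off-v (proj₁ (red-neighbour Rw)) aa w≢v a≢v pw≡pa) (≢a Rw)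

  bound : redDeg S′ a ≤ redDeg S (p a) + 1
  bound = count-≤-injection-but-one {E = Exceptional} (λ w → (w ≟ v) ⊎-dec (p w ≟ p a)) p exceptional-unique
    (λ {w} Rw ¬Ew → let aw , red-w = red-neighbour Rw in
      cong₂ _∧_ (rep-alive Qp w) (cong isRed (red-in-coarser Qp Qq refines aa aw (¬Ew ∘ inj₂ ∘ sym) red-w)))
    (λ Ru Rw ¬Eu ¬Ew →
      injective-off-v (proj₁ (red-neighbour Ru)) (proj₁ (red-neighbour Rw)) (¬Eu ∘ inj₁) (¬Ew ∘ inj₁))

uMerged-splitOff : {G : Trigraph n} {S S′ : State n} {p q : Fin n → Fin n} {v u₀ : Fin n} →
  IsQuotient G S p → SingleVertex S → IsQuotient G S′ q → SplitOff v p q → u₀ ≢ v →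
  UMerged (allBut v) S′
uMerged-splitOff {S′ = S′} {p} {q} {v} {u₀} Qp (_ , _ , single) Qq split u₀≢v =
  (q u₀ , allBut-true (v-alone u₀≢v) , rep-alive Qq u₀ , merged) , v-alive
  where
  open IsQuotient
  open SplitOff split
  merged : ∀ w → allBut v w ≡ true → alive S′ w ≡ true → w ≡ q u₀
  merged w w≢v aw = trans (sym (rep-fixed Qq aw)) (agrees (allBut-true⇒≢ w≢v) u₀≢v
    (trans (single (p w) (rep-alive Qp w)) (sym (single (p u₀) (rep-alive Qp u₀)))))
  v-alive : ∀ w → allBut v w ≡ false → alive S′ w ≡ true
  v-alive w w≡v rewrite allBut-false⇒≡ w≡v = subst (λ z → alive S′ z ≡ true) v-fixed (rep-alive Qq v)

other-member? : (v : Fin n) (p : Fin n → Fin n) (z : Fin n) → Dec (∃ λ u → u ≢ v × p u ≡ z)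
other-member? v p z = any? (λ u → ¬? (u ≟ v) ×-dec (p u ≟ z))

simulate : {G : Trigraph n} {v u₀ : Fin n} {t : ℕ} {S T S′ : State n} {p q : Fin n → Fin n} →
  CSeq everything t S T → SingleVertex T → IsQuotient G S p → IsQuotient G S′ q → SplitOff v p q → u₀ ≢ v →
  ∃ λ T′ → CSeq (allBut v) (t + 1) S′ T′ × UMerged (allBut v) T′
simulate {S′ = S′} (done rd) single Qp Qq split u₀≢v =
  S′ , done (redDeg-splitOff Qp Qq split rd) , uMerged-splitOff Qp single Qq split u₀≢v
simulate {v = v} {p = p} {q} (step x y rd ax ay x≢y _ _ rest) single Qp Qq split u₀≢v
  with other-member? v p x | other-member? v p y
... | no x-part⊆v | _ = simulate rest single (isQuotient-contract Qp ax ay x≢y) Qq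
  (splitOff-skip split (inj₁ refl) (λ u≢v pu≡x → x-part⊆v (_ , u≢v , pu≡x))) u₀≢v
... | yes _ | no y-part⊆v = simulate rest single (isQuotient-contract Qp ax ay x≢y) Qq
  (splitOff-skip split (inj₂ refl) (λ u≢v pu≡y → y-part⊆v (_ , u≢v , pu≡y))) u₀≢v
... | yes (u₁ , u₁≢v , pu₁≡x) | yes (u₂ , u₂≢v , pu₂≡y) =
  let T′ , rest′ , merged = simulate rest single (isQuotient-contract Qp ax ay x≢y)
                              (isQuotient-contract Qq (rep-alive u₁) (rep-alive u₂) qu₁≢qu₂)
                              (splitOff-contract split (v-alone u₁≢v) (v-alone u₂≢v) old-pair new-pair) u₀≢v
  in T′ , step (q u₁) (q u₂) (redDeg-splitOff Qp Qq split rd) (rep-alive u₁) (rep-alive u₂) qu₁≢qu₂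
              (allBut-true (v-alone u₁≢v)) (allBut-true (v-alone u₂≢v)) rest′ , merged
  where
  open IsQuotient Qq
  open SplitOff split
  qu₁≢qu₂ : q u₁ ≢ q u₂
  qu₁≢qu₂ e = x≢y (trans (sym pu₁≡x) (trans (refines e) pu₂≡y))
  old-pair : ∀ {u} → q u ∈[ q u₁ , q u₂ ] → p u ∈[ x , y ]
  old-pair = Sum.map (λ e → trans (refines e) pu₁≡x) (λ e → trans (refines e) pu₂≡y)
  new-pair : ∀ {u} → u ≢ v → p u ∈[ x , y ] → q u ∈[ q u₁ , q u₂ ]
  new-pair u≢v =
    Sum.map (λ e → agrees u≢v u₁≢v (trans e (sym pu₁≡x))) (λ e → agrees u≢v u₂≢v (trans e (sym pu₂≡y)))

lemma10 : ∀ {n} (G : Trigraph n) (v : Fin n) (t tU : ℕ) →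
    IsTww G t → IsTwwU G (allBut v) tU → tU ≤ t + 1
lemma10 G v t tU ((_ , seq , single) , _) ((_ , _ , ((u₀ , u₀∈U , _) , _)) , minimal) =
  minimal (t + 1) (simulate seq single (isQuotient-initial G) (isQuotient-initial G) (splitOff-initial v)
                     (allBut-true⇒≢ u₀∈U))
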